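{- Let $G=(V,E)$ be a graph and let $M(G)$ be its cycle matroid, i.e. the matroid on $E$ whose independent sets are the subsets of $E$ containing no cycle. For $S\subseteq V$ define \[ f(S)=\max\{|\mathcal{I}| : \mathcal{I}\subseteq E \text{ independent in } M(G),\ \text{every } e\in\mathcal{I} \text{ has at least one endpoint in } S\}. \] Then $f$ is submodular, i.e. $f(S)+f(T)\geq f(S\cup T)+f(S\cap T)$ for all $S,T\subseteq V$. -}

module Defs where

open import Data.Nat using (ℕ; suc; _≤_)
open import Data.Fin using (Fin; zero; suc; inject₁; fromℕ)
open import Data.Fin.Subset using (Subset; _∈_; ∣_∣)
open import Data.Product using (Σ; _×_; _,_; proj₁; proj₂)
open import Data.Sum using (_⊎_)
open import Function.Definitions using (Injective)
open import Relation.Binary.PropositionalEquality using (_≡_)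

-- A finite (multi)graph: vertices Fin n, edges Fin m, each edge has two
-- endpoints (loops and parallel edges allowed).
record Graph : Set where
  field
    n   : ℕ
    m   : ℕ
    ends : Fin m → Fin n × Fin n

open Graph public

Joins : (G : Graph) → Fin (m G) → Fin (n G) → Fin (n G) → Set
Joins G e u v = (ends G e ≡ (u , v)) ⊎ (ends G e ≡ (v , u))

-- A cycle of length L+1 ≥ 1 using only edges of I: distinct edges
-- e₀..e_L, distinct vertices v₀..v_L, with eᵢ joining vᵢ and vᵢ₊₁
-- (indices mod L+1; the closing vertex v_{L+1} is identified with v₀).
record Cycle (G : Graph) (I : Subset (m G)) : Set where
  field
    L      : ℕ
    edge   : Fin (suc L) → Fin (m G)
    vert   : Fin (suc (suc L)) → Fin (n G)
    closed : vert (fromℕ (suc L)) ≡ vert zero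
    edgeInj : Injective _≡_ _≡_ edge
    vertInj : Injective _≡_ _≡_ (λ i → vert (inject₁ i))
    inI    : ∀ i → edge i ∈ I
    joins  : ∀ i → Joins G (edge i) (vert (inject₁ i)) (vert (suc i))

Independent : (G : Graph) → Subset (m G) → Set
Independent G I = Cycle G I → Data.Empty.⊥
  where import Data.Empty

CoveredBy : (G : Graph) → Subset (n G) → Subset (m G) → Set
CoveredBy G S I = ∀ e → e ∈ I → (proj₁ (ends G e) ∈ S) ⊎ (proj₂ (ends G e) ∈ S)

Feasible : (G : Graph) → Subset (n G) → Subset (m G) → Set
Feasible G S I = Independent G I × CoveredBy G S I

-- "f(S) = k": k is the maximum of |I| over feasible I (attained, and an upper bound).
IsF : (G : Graph) → Subset (n G) → ℕ → Set
IsF G S k = (Σ (Subset (m G)) λ I → Feasible G S I × ∣ I ∣ ≡ k)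
          × (∀ I → Feasible G S I → ∣ I ∣ ≤ k)

module Submission where

-- Write X_S for the set of edges touching S.  Then f(S) is the rank of X_S in the
-- cycle matroid, X_{S∪T} = X_S ∪ X_T and X_{S∩T} ⊆ X_S ∩ X_T.  Take an optimal
-- forest I_d for S ∩ T and extend it greedily, inside X_{S∪T}, to a forest J whose
-- connected components contain every edge of X_{S∪T}.  Then
--   * f(S∪T) ≤ |J|, because a forest whose edges all lie inside the components of J
--     has at most |J| edges (the rank bound), and
--   * J ∩ X_S and J ∩ X_T are feasible for S and T, their union contains J and
--     their intersection contains I_d, so by |P ∪ Q| + |P ∩ Q| = |P| + |Q|,
--     f(S∪T) + f(S∩T) ≤ |J| + |I_d| ≤ |J ∩ X_S| + |J ∩ X_T| ≤ f(S) + f(T).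
-- The rank bound is proved by counting classes of the connectivity labelling of an
-- edge list: every edge merges at most two classes, and an edge of a forest always
-- merges two distinct classes (otherwise it would close a cycle).

open import Defs
open import Data.Nat using (ℕ; _+_; _≤_)
open import Data.Fin.Subset using (Subset; _∪_; _∩_)

open import Data.Nat using (suc)
open import Data.Nat.Properties using (≤-<-trans; ≮⇒≥; +-suc; +-comm; +-monoʳ-≤; +-monoˡ-≤; +-mono-≤; +-cancelʳ-≤; m≤m+n; module ≤-Reasoning)
open import Data.Bool using (true)
open import Data.Empty using (⊥-elim)
open import Data.Fin using (Fin; zero; suc; _<_; inject₁; fromℕ)
open import Data.Fin.Properties using (_≟_; _<?_; any?; <-cmp; <-asym; <-irrefl; suc-injective; inject₁-injective; fromℕ≢inject₁)
open import Data.Fin.Induction using (<-wellFounded)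
open import Data.Fin.Subset using (_∈_; _∉_; _⊆_; ⁅_⁆; ∣_∣; ⊤; inside; outside)
open import Data.Fin.Subset.Properties using (_∈?_; p⊆q⇒∣p∣≤∣q∣; p⊂q⇒∣p∣<∣q∣; ∣p∣≤n; ∣⊤∣≡n; ∣⁅x⁆∣≡1; x∈⁅x⁆; x∈⁅y⁆⇒x≡y; x∈p∪q⁺; x∈p∪q⁻; x∈p∩q⁺; x∈p∩q⁻; p⊆p∪q; p∩q⊆p)
open import Data.List using (List; []; _∷_; length; map; allFin)
open import Data.List.Properties using (length-map)
open import Data.List.Membership.Propositional using () renaming (_∈_ to _∈ₗ_)
open import Data.List.Membership.Propositional.Properties using (∈-map⁺; ∈-map⁻; ∈-allFin)
open import Data.List.Relation.Unary.Any using (here; there)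
import Data.List.Relation.Unary.All as All
import Data.List.Relation.Unary.All.Properties as All
open import Data.List.Relation.Unary.AllPairs using ([]; _∷_)
open import Data.List.Relation.Unary.Unique.Propositional using (Unique)
import Data.List.Relation.Unary.Unique.Propositional.Properties as Unique
open import Data.Product using (Σ; ∃; _×_; _,_; proj₁; proj₂)
open import Data.Sum using (_⊎_; inj₁; inj₂)
import Data.Sum as Sum
open import Data.Vec using ([]; _∷_; here; there; tabulate)
open import Data.Vec.Properties using (lookup∘tabulate; []=⇒lookup; lookup⇒[]=)
open import Function using (_∘_; id)
open import Function.Definitions using (Injective)
open import Induction.WellFounded using (Acc; acc)
open import Relation.Binary using (tri<; tri≈; tri>)
open import Relation.Binary.PropositionalEquality using (_≡_; _≢_; refl; sym; trans; cong; subst; module ≡-Reasoning)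
open import Relation.Nullary using (¬_; Dec; yes; no; does)
open import Relation.Nullary.Decidable using (dec-true; _×-dec_; _⊎-dec_)
open import Relation.Unary using (Pred; Decidable)

select : ∀ {k p} {P : Pred (Fin k) p} → Decidable P → Subset k
select P? = tabulate (λ x → does (P? x))

∈-select⁺ : ∀ {k p} {P : Pred (Fin k) p} (P? : Decidable P) {x} → P x → x ∈ select P?
∈-select⁺ P? {x} px = lookup⇒[]= x (select P?) (trans (lookup∘tabulate _ x) (dec-true (P? x) px))

∈-select⁻ : ∀ {k p} {P : Pred (Fin k) p} (P? : Decidable P) {x} → x ∈ select P? → P x
∈-select⁻ P? {x} x∈ = holds (P? x) (trans (sym (lookup∘tabulate _ x)) ([]=⇒lookup x∈))
  where
  holds : ∀ {A : Set _} (a? : Dec A) → does a? ≡ true → A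
  holds (yes a) _ = a
  holds (no _) ()

∣p∪q∣+∣p∩q∣ : ∀ {k} (p q : Subset k) → ∣ p ∪ q ∣ + ∣ p ∩ q ∣ ≡ ∣ p ∣ + ∣ q ∣
∣p∪q∣+∣p∩q∣ []            []            = refl
∣p∪q∣+∣p∩q∣ (inside  ∷ p) (inside  ∷ q) = cong suc (begin
  ∣ p ∪ q ∣ + suc ∣ p ∩ q ∣   ≡⟨ +-suc _ _ ⟩
  suc (∣ p ∪ q ∣ + ∣ p ∩ q ∣) ≡⟨ cong suc (∣p∪q∣+∣p∩q∣ p q) ⟩
  suc (∣ p ∣ + ∣ q ∣)         ≡⟨ +-suc _ _ ⟨
  ∣ p ∣ + suc ∣ q ∣           ∎)
  where open ≡-Reasoning
∣p∪q∣+∣p∩q∣ (inside  ∷ p) (outside ∷ q) = cong suc (∣p∪q∣+∣p∩q∣ p q)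
∣p∪q∣+∣p∩q∣ (outside ∷ p) (inside  ∷ q) = trans (cong suc (∣p∪q∣+∣p∩q∣ p q)) (sym (+-suc _ _))
∣p∪q∣+∣p∩q∣ (outside ∷ p) (outside ∷ q) = ∣p∪q∣+∣p∩q∣ p q

∣p∪q∣≤∣p∣+∣q∣ : ∀ {k} (p q : Subset k) → ∣ p ∪ q ∣ ≤ ∣ p ∣ + ∣ q ∣
∣p∪q∣≤∣p∣+∣q∣ p q = subst (∣ p ∪ q ∣ ≤_) (∣p∪q∣+∣p∩q∣ p q) (m≤m+n _ _)

elements : ∀ {k} → Subset k → List (Fin k)
elements []            = []
elements (inside  ∷ p) = zero ∷ map suc (elements p)
elements (outside ∷ p) = map suc (elements p)

length-elements : ∀ {k} (p : Subset k) → length (elements p) ≡ ∣ p ∣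
length-elements []            = refl
length-elements (inside  ∷ p) = cong suc (trans (length-map suc (elements p)) (length-elements p))
length-elements (outside ∷ p) = trans (length-map suc (elements p)) (length-elements p)

∈-elements⁺ : ∀ {k} (p : Subset k) {x} → x ∈ p → x ∈ₗ elements p
∈-elements⁺ (inside  ∷ p) here        = here refl
∈-elements⁺ (inside  ∷ p) (there x∈p) = there (∈-map⁺ suc (∈-elements⁺ p x∈p))
∈-elements⁺ (outside ∷ p) (there x∈p) = ∈-map⁺ suc (∈-elements⁺ p x∈p)

∈-elements⁻ : ∀ {k} (p : Subset k) {x} → x ∈ₗ elements p → x ∈ p
∈-elements⁻ (inside  ∷ p) (here refl) = here
∈-elements⁻ (inside  ∷ p) (there x∈)  with ∈-map⁻ suc x∈
... | _ , y∈ , refl = there (∈-elements⁻ p y∈)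
∈-elements⁻ (outside ∷ p) x∈          with ∈-map⁻ suc x∈
... | _ , y∈ , refl = there (∈-elements⁻ p y∈)

elements-unique : ∀ {k} (p : Subset k) → Unique (elements p)
elements-unique []            = []
elements-unique (inside  ∷ p) =
  All.map⁺ (All.universal (λ _ ()) (elements p)) ∷ Unique.map⁺ suc-injective (elements-unique p)
elements-unique (outside ∷ p) = Unique.map⁺ suc-injective (elements-unique p)

chain : ∀ {A : Set} {L} (h : Fin (suc L) → A) →
        (∀ j → h (inject₁ j) ≡ h (suc j)) → h zero ≡ h (fromℕ L)
chain {L = 0}     h steps = refl
chain {L = suc L} h steps = trans (steps zero) (chain (h ∘ suc) (steps ∘ suc))

-- In a closed sequence g₀ … g_{L+1} = g₀, if every consecutive pair except the
-- i-th is equal, then so is the i-th.  (A cycle minus one edge still connects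
-- the endpoints of that edge.)
closed-chain : ∀ {A : Set} L (g : Fin (suc (suc L)) → A) → g (fromℕ (suc L)) ≡ g zero →
               (i : Fin (suc L)) → (∀ j → j ≢ i → g (inject₁ j) ≡ g (suc j)) →
               g (inject₁ i) ≡ g (suc i)
closed-chain L g closed zero steps =
  sym (trans (chain (g ∘ suc) (λ j → steps (suc j) (λ ()))) closed)
closed-chain (suc L) g closed (suc i) steps =
  closed-chain L (g ∘ suc) (trans closed (steps zero (λ ()))) i
               (λ j j≢i → steps (suc j) (j≢i ∘ suc-injective))

-- A labelling puts two points in the same class iff they receive the same label.
Labelling : ℕ → Set
Labelling k = Fin k → Fin k

module _ {k : ℕ} where

  Refines : Labelling k → Labelling k → Set
  Refines lab lab′ = ∀ {u v} → lab u ≡ lab v → lab′ u ≡ lab′ v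

  merge : Labelling k → Fin k → Fin k → Labelling k
  merge lab x y v with lab v ≟ lab y
  ... | yes _ = lab x
  ... | no  _ = lab v

  merge-refines : ∀ lab x y → Refines lab (merge lab x y)
  merge-refines lab x y {u} {v} u~v with lab u ≟ lab y | lab v ≟ lab y
  ... | yes _   | yes _   = refl
  ... | yes u~y | no  v≁y = ⊥-elim (v≁y (trans (sym u~v) u~y))
  ... | no  u≁y | yes v~y = ⊥-elim (u≁y (trans u~v v~y))
  ... | no  _   | no  _   = u~v

  merge-x : ∀ lab x y → merge lab x y x ≡ lab x
  merge-x lab x y with lab x ≟ lab y
  ... | yes _ = refl
  ... | no  _ = refl

  merge-y : ∀ lab x y → merge lab x y y ≡ lab x
  merge-y lab x y with lab y ≟ lab y
  ... | yes _   = refl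
  ... | no  y≁y = ⊥-elim (y≁y refl)

  merge-split : ∀ lab x y {u v} → merge lab x y u ≡ merge lab x y v →
                lab u ≡ lab v ⊎ (lab u ≡ lab y × lab v ≡ lab x) ⊎ (lab u ≡ lab x × lab v ≡ lab y)
  merge-split lab x y {u} {v} u≈v with lab u ≟ lab y | lab v ≟ lab y
  ... | yes u~y | yes v~y = inj₁ (trans u~y (sym v~y))
  ... | yes u~y | no  _   = inj₂ (inj₁ (u~y , sym u≈v))
  ... | no  _   | yes v~y = inj₂ (inj₂ (u≈v , v~y))
  ... | no  _   | no  _   = inj₁ u≈v

  -- Each class is represented by its least element, its root.
  IsRoot : Labelling k → Fin k → Set
  IsRoot lab v = ∀ u → u < v → lab u ≢ lab v

  root-or-below : ∀ lab v → IsRoot lab v ⊎ ∃ λ u → u < v × lab u ≡ lab v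
  root-or-below lab v with any? (λ u → (u <? v) ×-dec (lab u ≟ lab v))
  ... | yes below = inj₂ below
  ... | no  none  = inj₁ (λ u u<v u~v → none (u , u<v , u~v))

  isRoot? : ∀ lab → Decidable (IsRoot lab)
  isRoot? lab v with root-or-below lab v
  ... | inj₁ root              = yes root
  ... | inj₂ (u , u<v , u~v)   = no (λ root → root u u<v u~v)

  Roots : Labelling k → Subset k
  Roots lab = select (isRoot? lab)

  classes : Labelling k → ℕ
  classes lab = ∣ Roots lab ∣

  rootOf : ∀ lab v → ∃ λ r → lab r ≡ lab v × IsRoot lab r
  rootOf lab v = descend v (<-wellFounded v)
    where
    descend : ∀ w → Acc _<_ w → ∃ λ r → lab r ≡ lab w × IsRoot lab r
    descend w (acc below) with root-or-below lab w
    ... | inj₁ root = w , refl , root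
    ... | inj₂ (u , u<w , u~w) with descend u (below u<w)
    ...   | r , r~u , root = r , trans r~u u~w , root

  root-unique : ∀ lab {r s} → IsRoot lab r → IsRoot lab s → lab r ≡ lab s → r ≡ s
  root-unique lab {r} {s} r-root s-root r~s with <-cmp r s
  ... | tri< r<s _ _ = ⊥-elim (s-root r r<s r~s)
  ... | tri≈ _ r≡s _ = r≡s
  ... | tri> _ _ s<r = ⊥-elim (r-root s s<r (sym r~s))

  root-below : ∀ lab {r u v : Fin k} → IsRoot lab r → lab u ≡ lab r → u < v → r < v
  root-below lab r-root u~r u<v = ≤-<-trans (≮⇒≥ (λ u<r → r-root _ u<r u~r)) u<v

  Roots-⊆ : ∀ {lab lab′} → Refines lab lab′ → Roots lab′ ⊆ Roots lab
  Roots-⊆ {lab} {lab′} ref v∈ =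
    ∈-select⁺ (isRoot? lab) (λ u u<v u~v → ∈-select⁻ (isRoot? lab′) v∈ u u<v (ref u~v))

  classes-antitone : ∀ {lab lab′} → Refines lab lab′ → classes lab′ ≤ classes lab
  classes-antitone ref = p⊆q⇒∣p∣≤∣q∣ (Roots-⊆ ref)

  classes-id : k ≤ classes id
  classes-id = subst (_≤ classes id) (∣⊤∣≡n k)
    (p⊆q⇒∣p∣≤∣q∣ {p = ⊤} (λ {v} _ → ∈-select⁺ (isRoot? id) (λ u u<v u≡v → <-irrefl u≡v u<v)))

  larger : Fin k → Fin k → Fin k
  larger a b with a <? b
  ... | yes _ = b
  ... | no  _ = a

  larger-left : ∀ {a b} → b < a → larger a b ≡ a
  larger-left {a} {b} b<a with a <? b
  ... | yes a<b = ⊥-elim (<-asym a<b b<a)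
  ... | no  _   = refl

  larger-right : ∀ {a b} → a < b → larger a b ≡ b
  larger-right {a} {b} a<b with a <? b
  ... | yes _   = refl
  ... | no  a≮b = ⊥-elim (a≮b a<b)

  lost-root : ∀ lab x y {rx ry u v} → lab rx ≡ lab x → IsRoot lab rx → lab ry ≡ lab y → IsRoot lab ry →
              IsRoot lab v → u < v → merge lab x y u ≡ merge lab x y v → v ≡ larger rx ry
  lost-root lab x y {rx} {ry} rx~x rx-root ry~y ry-root v-root u<v u≈v with merge-split lab x y u≈v
  ... | inj₁ u~v = ⊥-elim (v-root _ u<v u~v)
  ... | inj₂ (inj₁ (u~y , v~x)) =
    let v≡rx = root-unique lab v-root rx-root (trans v~x (sym rx~x))
    in trans v≡rx (sym (larger-left (subst (ry <_) v≡rx (root-below lab ry-root (trans u~y (sym ry~y)) u<v))))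
  ... | inj₂ (inj₂ (u~x , v~y)) =
    let v≡ry = root-unique lab v-root ry-root (trans v~y (sym ry~y))
    in trans v≡ry (sym (larger-right (subst (rx <_) v≡ry (root-below lab rx-root (trans u~x (sym rx~x)) u<v))))

  merge-classes-≥ : ∀ lab x y → classes lab ≤ suc (classes (merge lab x y))
  merge-classes-≥ lab x y with rootOf lab x | rootOf lab y
  ... | rx , rx~x , rx-root | ry , ry~y , ry-root = begin
    classes lab                                   ≤⟨ p⊆q⇒∣p∣≤∣q∣ survivors ⟩
    ∣ Roots (merge lab x y) ∪ ⁅ larger rx ry ⁆ ∣   ≤⟨ ∣p∪q∣≤∣p∣+∣q∣ (Roots (merge lab x y)) ⁅ larger rx ry ⁆ ⟩
    classes (merge lab x y) + ∣ ⁅ larger rx ry ⁆ ∣ ≡⟨ cong (classes (merge lab x y) +_) (∣⁅x⁆∣≡1 (larger rx ry)) ⟩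
    classes (merge lab x y) + 1                   ≡⟨ +-comm _ 1 ⟩
    suc (classes (merge lab x y))                 ∎
    where
    open ≤-Reasoning
    survivors : Roots lab ⊆ Roots (merge lab x y) ∪ ⁅ larger rx ry ⁆
    survivors {v} v∈ with root-or-below (merge lab x y) v
    ... | inj₁ root = x∈p∪q⁺ (inj₁ (∈-select⁺ (isRoot? _) root))
    ... | inj₂ (u , u<v , u≈v) =
      x∈p∪q⁺ (inj₂ (subst (_∈ ⁅ larger rx ry ⁆)
        (sym (lost-root lab x y rx~x rx-root ry~y ry-root (∈-select⁻ (isRoot? lab) v∈) u<v u≈v))
        (x∈⁅x⁆ _)))

  merge-classes-< : ∀ lab x y → lab x ≢ lab y → suc (classes (merge lab x y)) ≤ classes lab
  merge-classes-< lab x y x≁y with rootOf lab x | rootOf lab y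
  ... | rx , rx~x , rx-root | ry , ry~y , ry-root =
    p⊂q⇒∣p∣<∣q∣ (Roots-⊆ (merge-refines lab x y) , lost)
    where
    rx≈ry : merge lab x y rx ≡ merge lab x y ry
    rx≈ry = trans (trans (merge-refines lab x y rx~x) (merge-x lab x y))
                  (sym (trans (merge-refines lab x y ry~y) (merge-y lab x y)))
    lost : ∃ λ v → v ∈ Roots lab × v ∉ Roots (merge lab x y)
    lost with <-cmp rx ry
    ... | tri< rx<ry _ _ = ry , ∈-select⁺ (isRoot? lab) ry-root ,
                           (λ ry∈ → ∈-select⁻ (isRoot? _) ry∈ rx rx<ry rx≈ry)
    ... | tri≈ _ rx≡ry _ = ⊥-elim (x≁y (trans (sym rx~x) (trans (cong lab rx≡ry) ry~y)))
    ... | tri> _ _ ry<rx = rx , ∈-select⁺ (isRoot? lab) rx-root ,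
                           (λ rx∈ → ∈-select⁻ (isRoot? _) rx∈ ry ry<rx (sym rx≈ry))

module Forests (G : Graph) where

  V E : Set
  V = Fin (n G)
  E = Fin (m G)

  src tgt : E → V
  src e = proj₁ (ends G e)
  tgt e = proj₂ (ends G e)

  Spans : Labelling (n G) → E → Set
  Spans lab e = lab (src e) ≡ lab (tgt e)

  spans⇒joined : ∀ lab {e u w} → Joins G e u w → Spans lab e → lab u ≡ lab w
  spans⇒joined lab (inj₁ e=uw) s = subst (λ p → lab (proj₁ p) ≡ lab (proj₂ p)) e=uw s
  spans⇒joined lab (inj₂ e=wu) s = sym (subst (λ p → lab (proj₁ p) ≡ lab (proj₂ p)) e=wu s)

  joined⇒spans : ∀ lab {e u w} → Joins G e u w → lab u ≡ lab w → Spans lab e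
  joined⇒spans lab (inj₁ e=uw) u~w = subst (λ p → lab (proj₁ p) ≡ lab (proj₂ p)) (sym e=uw) u~w
  joined⇒spans lab (inj₂ e=wu) u~w = subst (λ p → lab (proj₁ p) ≡ lab (proj₂ p)) (sym e=wu) (sym u~w)

  joins-endpoint : ∀ {e u w a b} → Joins G e u w → Joins G e a b → u ≡ a ⊎ u ≡ b
  joins-endpoint (inj₁ e=uw) (inj₁ e=ab) = inj₁ (cong proj₁ (trans (sym e=uw) e=ab))
  joins-endpoint (inj₁ e=uw) (inj₂ e=ba) = inj₂ (cong proj₁ (trans (sym e=uw) e=ba))
  joins-endpoint (inj₂ e=wu) (inj₁ e=ab) = inj₂ (cong proj₂ (trans (sym e=wu) e=ab))
  joins-endpoint (inj₂ e=wu) (inj₂ e=ba) = inj₁ (cong proj₂ (trans (sym e=wu) e=ba))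

  data Walk (P : E → Set) : V → V → Set where
    nil  : ∀ {u} → Walk P u u
    cons : ∀ {u w v} (e : E) → P e → Joins G e u w → Walk P w v → Walk P u v

  _++ʷ_ : ∀ {P u w v} → Walk P u w → Walk P w v → Walk P u v
  nil             ++ʷ q = q
  cons e pe j p   ++ʷ q = cons e pe j (p ++ʷ q)

  mapʷ : ∀ {P Q : E → Set} → (∀ {e} → P e → Q e) → ∀ {u v} → Walk P u v → Walk Q u v
  mapʷ f nil             = nil
  mapʷ f (cons e pe j p) = cons e (f pe) j (mapʷ f p)

  walk-respects : ∀ {P} lab → (∀ {e} → P e → Spans lab e) → ∀ {u v} → Walk P u v → lab u ≡ lab v
  walk-respects lab spans nil             = refl
  walk-respects lab spans (cons e pe j p) = trans (spans⇒joined lab j (spans pe)) (walk-respects lab spans p)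

  steps : ∀ {P u v} → Walk P u v → ℕ
  steps nil             = 0
  steps (cons _ _ _ p)  = suc (steps p)

  vertexAt : ∀ {P u v} (p : Walk P u v) → Fin (suc (steps p)) → V
  vertexAt {u = u} nil            zero    = u
  vertexAt {u = u} (cons _ _ _ p) zero    = u
  vertexAt         (cons _ _ _ p) (suc i) = vertexAt p i

  edgeAt : ∀ {P u v} (p : Walk P u v) → Fin (steps p) → E
  edgeAt (cons e _ _ p) zero    = e
  edgeAt (cons _ _ _ p) (suc i) = edgeAt p i

  edgeAt-P : ∀ {P u v} (p : Walk P u v) i → P (edgeAt p i)
  edgeAt-P (cons _ pe _ p) zero    = pe
  edgeAt-P (cons _ _  _ p) (suc i) = edgeAt-P p i

  vertexAt-first : ∀ {P u v} (p : Walk P u v) → vertexAt p zero ≡ u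
  vertexAt-first nil            = refl
  vertexAt-first (cons _ _ _ p) = refl

  vertexAt-last : ∀ {P u v} (p : Walk P u v) → vertexAt p (fromℕ (steps p)) ≡ v
  vertexAt-last nil            = refl
  vertexAt-last (cons _ _ _ p) = vertexAt-last p

  edgeAt-joins : ∀ {P u v} (p : Walk P u v) i → Joins G (edgeAt p i) (vertexAt p (inject₁ i)) (vertexAt p (suc i))
  edgeAt-joins (cons e _ j p) zero    = subst (Joins G e _) (sym (vertexAt-first p)) j
  edgeAt-joins (cons _ _ _ p) (suc i) = edgeAt-joins p i

  Simple : ∀ {P u v} → Walk P u v → Set
  Simple p = Injective _≡_ _≡_ (vertexAt p) × Injective _≡_ _≡_ (edgeAt p)

  simple-nil : ∀ {P u} → Simple (nil {P} {u})
  simple-nil = (λ { {zero} {zero} _ → refl }) , (λ { {()} })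

  simple-tail : ∀ {P u w v e pe} {j : Joins G e u w} {q : Walk P w v} → Simple (cons e pe j q) → Simple q
  simple-tail (vertex-inj , edge-inj) = suc-injective ∘ vertex-inj , suc-injective ∘ edge-inj

  -- Prepending an edge from a vertex not on a path gives a path; the new edge is
  -- not on the path because one of its endpoints is not.
  simple-cons : ∀ {P u w v e pe} (j : Joins G e u w) (q : Walk P w v) → Simple q →
                (∀ i → vertexAt q i ≢ u) → Simple (cons e pe j q)
  simple-cons {e = e} j q (vertex-inj , edge-inj) u∉q = vertex-inj′ , edge-inj′
    where
    vertex-inj′ : Injective _≡_ _≡_ (vertexAt (cons _ _ j q))
    vertex-inj′ {zero}  {zero}  _  = refl
    vertex-inj′ {zero}  {suc b} eq = ⊥-elim (u∉q b (sym eq))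
    vertex-inj′ {suc a} {zero}  eq = ⊥-elim (u∉q a eq)
    vertex-inj′ {suc a} {suc b} eq = cong suc (vertex-inj eq)
    new-edge : ∀ b → e ≢ edgeAt q b
    new-edge b e≡ with joins-endpoint j (subst (λ f → Joins G f _ _) (sym e≡) (edgeAt-joins q b))
    ... | inj₁ u≡ = u∉q (inject₁ b) (sym u≡)
    ... | inj₂ u≡ = u∉q (suc b) (sym u≡)
    edge-inj′ : Injective _≡_ _≡_ (edgeAt (cons e _ j q))
    edge-inj′ {zero}  {zero}  _  = refl
    edge-inj′ {zero}  {suc b} eq = ⊥-elim (new-edge b eq)
    edge-inj′ {suc a} {zero}  eq = ⊥-elim (new-edge a (sym eq))
    edge-inj′ {suc a} {suc b} eq = cong suc (edge-inj eq)

  suffixFrom : ∀ {P u w v} (q : Walk P w v) → Simple q → (i : Fin (suc (steps q))) → vertexAt q i ≡ u →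
               Σ (Walk P u v) Simple
  suffixFrom nil             s zero    refl = nil , s
  suffixFrom (cons e pe j q) s zero    refl = cons e pe j q , s
  suffixFrom (cons _ _ _ q)  s (suc i) q-i≡u = suffixFrom q (simple-tail s) i q-i≡u

  simplify : ∀ {P u v} → Walk P u v → Σ (Walk P u v) Simple
  simplify nil = nil , simple-nil
  simplify {u = u} (cons e pe j rest) with simplify rest
  ... | q , q-simple with any? (λ i → vertexAt q i ≟ u)
  ...   | yes (i , q-i≡u) = suffixFrom q q-simple i q-i≡u
  ...   | no  u∉q         = cons e pe j q , simple-cons j q q-simple (λ i q-i≡u → u∉q (i , q-i≡u))

  close-cycle : ∀ {I P x y} (e : E) → ends G e ≡ (x , y) → e ∈ I →
                (∀ {f} → P f → f ∈ I × f ≢ e) → (p : Walk P x y) → Simple p → Cycle G I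
  close-cycle {I} {P} {x} {y} e e=xy e∈I others p (vertex-inj , edge-inj) = record
    { L = steps p ; edge = edge ; vert = vert ; closed = vertexAt-last p
    ; edgeInj = edge-inj′ ; vertInj = vert-inj ; inI = inI ; joins = joins }
    where
    edge : Fin (suc (steps p)) → E
    edge zero    = e
    edge (suc i) = edgeAt p i
    vert : Fin (suc (suc (steps p))) → V
    vert zero    = y
    vert (suc i) = vertexAt p i
    edge-inj′ : Injective _≡_ _≡_ edge
    edge-inj′ {zero}  {zero}  _  = refl
    edge-inj′ {zero}  {suc b} eq = ⊥-elim (proj₂ (others (edgeAt-P p b)) (sym eq))
    edge-inj′ {suc a} {zero}  eq = ⊥-elim (proj₂ (others (edgeAt-P p a)) eq)
    edge-inj′ {suc a} {suc b} eq = cong suc (edge-inj eq)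
    vert-inj : Injective _≡_ _≡_ (vert ∘ inject₁)
    vert-inj {zero}  {zero}  _  = refl
    vert-inj {zero}  {suc b} eq = ⊥-elim (fromℕ≢inject₁ (vertex-inj (trans (vertexAt-last p) eq)))
    vert-inj {suc a} {zero}  eq = ⊥-elim (fromℕ≢inject₁ (vertex-inj (trans (vertexAt-last p) (sym eq))))
    vert-inj {suc a} {suc b} eq = cong suc (inject₁-injective (vertex-inj eq))
    inI : ∀ i → edge i ∈ I
    inI zero    = e∈I
    inI (suc i) = proj₁ (others (edgeAt-P p i))
    joins : ∀ i → Joins G (edge i) (vert (inject₁ i)) (vert (suc i))
    joins zero    = inj₂ (trans e=xy (cong (_, y) (sym (vertexAt-first p))))
    joins (suc i) = edgeAt-joins p i

  restrict-cycle : ∀ {I J} (c : Cycle G I) → (∀ i → Cycle.edge c i ∈ J) → Cycle G J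
  restrict-cycle c inJ = record
    { L = Cycle.L c ; edge = Cycle.edge c ; vert = Cycle.vert c ; closed = Cycle.closed c
    ; edgeInj = Cycle.edgeInj c ; vertInj = Cycle.vertInj c ; inI = inJ ; joins = Cycle.joins c }

  independent-⊆ : ∀ {I J} → J ⊆ I → Independent G I → Independent G J
  independent-⊆ J⊆I I-indep c = I-indep (restrict-cycle c (J⊆I ∘ Cycle.inI c))

  -- The connectivity labelling of an edge list: two vertices share a label iff
  -- they are joined by a walk through the list.
  components : List E → Labelling (n G)
  components []       = id
  components (e ∷ es) = merge (components es) (src e) (tgt e)

  components-spans : ∀ l {e} → e ∈ₗ l → Spans (components l) e
  components-spans (e ∷ es) (here refl) =
    trans (merge-x (components es) (src e) (tgt e)) (sym (merge-y (components es) (src e) (tgt e)))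
  components-spans (e ∷ es) (there e′∈) =
    merge-refines (components es) (src e) (tgt e) (components-spans es e′∈)

  components-walk : ∀ l {u v} → components l u ≡ components l v → Walk (_∈ₗ l) u v
  components-walk []       refl = nil
  components-walk (e ∷ es) u≈v with merge-split (components es) (src e) (tgt e) u≈v
  ... | inj₁ u~v = mapʷ there (components-walk es u~v)
  ... | inj₂ (inj₁ (u~t , v~s)) =
    mapʷ there (components-walk es u~t) ++ʷ cons e (here refl) (inj₂ refl) (mapʷ there (components-walk es (sym v~s)))
  ... | inj₂ (inj₂ (u~s , v~t)) =
    mapʷ there (components-walk es u~s) ++ʷ cons e (here refl) (inj₁ refl) (mapʷ there (components-walk es (sym v~t)))

  components-least : ∀ l lab → (∀ {e} → e ∈ₗ l → Spans lab e) → Refines (components l) lab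
  components-least l lab spans u≈v = walk-respects lab spans (components-walk l u≈v)

  -- Each edge of a list removes at most one class: |V| ≤ |l| + #classes.
  components-lower : ∀ l → n G ≤ length l + classes (components l)
  components-lower []       = classes-id
  components-lower (e ∷ es) = begin
    n G                                               ≤⟨ components-lower es ⟩
    length es + classes (components es)               ≤⟨ +-monoʳ-≤ (length es) (merge-classes-≥ (components es) (src e) (tgt e)) ⟩
    length es + suc (classes (components (e ∷ es)))   ≡⟨ +-suc _ _ ⟩
    length (e ∷ es) + classes (components (e ∷ es))   ∎
    where open ≤-Reasoning

  -- Each edge of a repetition-free list of forest edges removes exactly one class,
  -- since an edge joining two vertices of one class would close a cycle.
  forest-components : ∀ {I} → Independent G I → ∀ l → Unique l → (∀ {e} → e ∈ₗ l → e ∈ I) →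
                      length l + classes (components l) ≤ n G
  forest-components I-indep []       _              _   = ∣p∣≤n (Roots id)
  forest-components {I} I-indep (e ∷ es) (e∉es ∷ es-unique) inI = begin
    length (e ∷ es) + classes (components (e ∷ es))   ≡⟨ +-suc _ _ ⟨
    length es + suc (classes (components (e ∷ es)))   ≤⟨ +-monoʳ-≤ (length es) (merge-classes-< (components es) (src e) (tgt e) bridge) ⟩
    length es + classes (components es)               ≤⟨ forest-components I-indep es es-unique (inI ∘ there) ⟩
    n G                                               ∎
    where
    open ≤-Reasoning
    others : ∀ {f} → f ∈ₗ es → f ∈ I × f ≢ e
    others f∈ = inI (there f∈) , (λ f≡e → All.lookup e∉es f∈ (sym f≡e))
    bridge : ¬ Spans (components es) e
    bridge spanned with simplify (components-walk es spanned)
    ... | p , p-simple = I-indep (close-cycle e refl (inI (here refl)) others p p-simple)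

  conn : Subset (m G) → Labelling (n G)
  conn J = components (elements J)

  conn-spans : ∀ J {e} → e ∈ J → Spans (conn J) e
  conn-spans J e∈ = components-spans (elements J) (∈-elements⁺ J e∈)

  conn-mono : ∀ {J J′} → J ⊆ J′ → Refines (conn J) (conn J′)
  conn-mono {J} {J′} J⊆J′ = components-least (elements J) (conn J′) (conn-spans J′ ∘ J⊆J′ ∘ ∈-elements⁻ J)

  rank-bound : ∀ {I} J → Independent G I → (∀ e → e ∈ I → Spans (conn J) e) → ∣ I ∣ ≤ ∣ J ∣
  rank-bound {I} J I-indep spanned = +-cancelʳ-≤ (classes (conn I)) ∣ I ∣ ∣ J ∣ (begin
    ∣ I ∣ + classes (conn I)                 ≡⟨ cong (_+ classes (conn I)) (length-elements I) ⟨
    length (elements I) + classes (conn I)   ≤⟨ forest-components I-indep (elements I) (elements-unique I) (∈-elements⁻ I) ⟩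
    n G                                      ≤⟨ components-lower (elements J) ⟩
    length (elements J) + classes (conn J)   ≤⟨ +-monoʳ-≤ _ (classes-antitone I⊑J) ⟩
    length (elements J) + classes (conn I)   ≡⟨ cong (_+ classes (conn I)) (length-elements J) ⟩
    ∣ J ∣ + classes (conn I)                 ∎)
    where
    open ≤-Reasoning
    I⊑J : Refines (conn I) (conn J)
    I⊑J = components-least (elements I) (conn J) (λ e∈ → spanned _ (∈-elements⁻ I e∈))

  -- Adding an edge whose endpoints lie in different components of a forest J
  -- yields a forest: a cycle through the new edge would connect its endpoints in J.
  add-bridge : ∀ {J} e → Independent G J → ¬ Spans (conn J) e → Independent G (J ∪ ⁅ e ⁆)
  add-bridge {J} e J-indep bridge c with any? (λ i → Cycle.edge c i ≟ e)
  ... | no e∉c = J-indep (restrict-cycle c inJ)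
    where
    inJ : ∀ i → Cycle.edge c i ∈ J
    inJ i = Sum.[ id , (λ i∈e → ⊥-elim (e∉c (i , x∈⁅y⁆⇒x≡y e i∈e))) ]′ (x∈p∪q⁻ J ⁅ e ⁆ (Cycle.inI c i))
  ... | yes (i , edge-i≡e) = bridge (joined⇒spans (conn J) e-joins
          (closed-chain (Cycle.L c) (conn J ∘ Cycle.vert c) (cong (conn J) (Cycle.closed c)) i other-steps))
    where
    e-joins : Joins G e (Cycle.vert c (inject₁ i)) (Cycle.vert c (suc i))
    e-joins = subst (λ f → Joins G f _ _) edge-i≡e (Cycle.joins c i)
    other-steps : ∀ j → j ≢ i → conn J (Cycle.vert c (inject₁ j)) ≡ conn J (Cycle.vert c (suc j))
    other-steps j j≢i with x∈p∪q⁻ J ⁅ e ⁆ (Cycle.inI c j)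
    ... | inj₁ j∈J = spans⇒joined (conn J) (Cycle.joins c j) (conn-spans J j∈J)
    ... | inj₂ j∈e = ⊥-elim (j≢i (Cycle.edgeInj c (trans (x∈⁅y⁆⇒x≡y e j∈e) (sym edge-i≡e))))

  Touches : Subset (n G) → E → Set
  Touches A e = src e ∈ A ⊎ tgt e ∈ A

  touches? : ∀ A → Decidable (Touches A)
  touches? A e = (src e ∈? A) ⊎-dec (tgt e ∈? A)

  touched : Subset (n G) → Subset (m G)
  touched A = select (touches? A)

  absorb : ∀ A e J → Feasible G A J →
           Σ (Subset (m G)) λ J′ → J ⊆ J′ × Feasible G A J′ × (Touches A e → Spans (conn J′) e)
  absorb A e J (J-indep , J-cov) with touches? A e | conn J (src e) ≟ conn J (tgt e)
  ... | no  e-out | _         = J , id , (J-indep , J-cov) , (λ e-in → ⊥-elim (e-out e-in))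
  ... | yes _     | yes spans = J , id , (J-indep , J-cov) , (λ _ → spans)
  ... | yes e-in  | no bridge =
    J ∪ ⁅ e ⁆ , p⊆p∪q ⁅ e ⁆ , (add-bridge e J-indep bridge , cov) ,
    (λ _ → conn-spans (J ∪ ⁅ e ⁆) (x∈p∪q⁺ (inj₂ (x∈⁅x⁆ e))))
    where
    cov : CoveredBy G A (J ∪ ⁅ e ⁆)
    cov f f∈ = Sum.[ J-cov f , (λ f∈e → subst (Touches A) (sym (x∈⁅y⁆⇒x≡y e f∈e)) e-in) ]′ (x∈p∪q⁻ J ⁅ e ⁆ f∈)

  extend : ∀ A (l : List E) J → Feasible G A J →
           Σ (Subset (m G)) λ J′ → J ⊆ J′ × Feasible G A J′ × (∀ {e} → e ∈ₗ l → Touches A e → Spans (conn J′) e)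
  extend A []       J J-feasible = J , id , J-feasible , λ ()
  extend A (e ∷ es) J J-feasible with absorb A e J J-feasible
  ... | J₁ , J⊆J₁ , J₁-feasible , e-spanned with extend A es J₁ J₁-feasible
  ...   | J₂ , J₁⊆J₂ , J₂-feasible , es-spanned =
    J₂ , J₁⊆J₂ ∘ J⊆J₁ , J₂-feasible ,
    λ { (here refl) e-in → conn-mono J₁⊆J₂ (e-spanned e-in) ; (there f∈) f-in → es-spanned f∈ f-in }

  record Spanning (A : Subset (n G)) (I : Subset (m G)) : Set where
    field
      forest   : Subset (m G)
      contains : I ⊆ forest
      feasible : Feasible G A forest
      spans    : ∀ e → Touches A e → Spans (conn forest) e

  spanning-extension : ∀ A I → Feasible G A I → Spanning A I
  spanning-extension A I I-feasible with extend A (allFin (m G)) I I-feasible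
  ... | J , I⊆J , J-feasible , spanned = record
    { forest = J ; contains = I⊆J ; feasible = J-feasible ; spans = λ e → spanned (∈-allFin e) }

  touching-part-feasible : ∀ S {J} → Independent G J → Feasible G S (J ∩ touched S)
  touching-part-feasible S {J} J-indep =
    independent-⊆ (p∩q⊆p J (touched S)) J-indep ,
    (λ e e∈ → ∈-select⁻ (touches? S) (proj₂ (x∈p∩q⁻ J (touched S) e∈)))

  split-∪ : ∀ S T {J} → CoveredBy G (S ∪ T) J → J ⊆ (J ∩ touched S) ∪ (J ∩ touched T)
  split-∪ S T {J} J-cov {e} e∈ = x∈p∪q⁺ (Sum.map (part S) (part T) (touches-∪ (J-cov e e∈)))
    where
    part : ∀ A → Touches A e → e ∈ J ∩ touched A
    part A e-in = x∈p∩q⁺ (e∈ , ∈-select⁺ (touches? A) e-in)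
    touches-∪ : Touches (S ∪ T) e → Touches S e ⊎ Touches T e
    touches-∪ (inj₁ s∈) = Sum.map inj₁ inj₁ (x∈p∪q⁻ S T s∈)
    touches-∪ (inj₂ t∈) = Sum.map inj₂ inj₂ (x∈p∪q⁻ S T t∈)

  split-∩ : ∀ S T {I J} → I ⊆ J → CoveredBy G (S ∩ T) I → I ⊆ (J ∩ touched S) ∩ (J ∩ touched T)
  split-∩ S T {I} {J} I⊆J I-cov {e} e∈ =
    x∈p∩q⁺ (part S (Sum.map (proj₁ ∘ x∈p∩q⁻ S T) (proj₁ ∘ x∈p∩q⁻ S T) (I-cov e e∈)) ,
            part T (Sum.map (proj₂ ∘ x∈p∩q⁻ S T) (proj₂ ∘ x∈p∩q⁻ S T) (I-cov e e∈)))
    where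
    part : ∀ A → Touches A e → e ∈ J ∩ touched A
    part A e-in = x∈p∩q⁺ (I⊆J e∈ , ∈-select⁺ (touches? A) e-in)

  ∩-feasible-∪ : ∀ S T {I} → Feasible G (S ∩ T) I → Feasible G (S ∪ T) I
  ∩-feasible-∪ S T (I-indep , I-cov) = I-indep ,
    (λ e e∈ → Sum.map widen widen (I-cov e e∈))
    where
    widen : ∀ {v} → v ∈ S ∩ T → v ∈ S ∪ T
    widen v∈ = x∈p∪q⁺ (inj₁ (p∩q⊆p S T v∈))

lemma1 : (G : Graph) (S T : Subset (n G)) (a b c d : ℕ) →
         IsF G S a → IsF G T b → IsF G (S ∪ T) c → IsF G (S ∩ T) d →
         c + d ≤ a + b
lemma1 G S T a b _ _ (_ , S-max) (_ , T-max) ((Ic , (Ic-indep , Ic-cov) , refl) , _) ((Id , Id-feasible , refl) , _) =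
  begin
  ∣ Ic ∣ + ∣ Id ∣              ≤⟨ +-monoˡ-≤ ∣ Id ∣ (rank-bound J Ic-indep (λ e e∈ → spans e (Ic-cov e e∈))) ⟩
  ∣ J ∣ + ∣ Id ∣               ≤⟨ +-mono-≤ (p⊆q⇒∣p∣≤∣q∣ (split-∪ S T (proj₂ feasible)))
                                            (p⊆q⇒∣p∣≤∣q∣ (split-∩ S T contains (proj₂ Id-feasible))) ⟩
  ∣ JS ∪ JT ∣ + ∣ JS ∩ JT ∣    ≡⟨ ∣p∪q∣+∣p∩q∣ JS JT ⟩
  ∣ JS ∣ + ∣ JT ∣              ≤⟨ +-mono-≤ (S-max JS (touching-part-feasible S (proj₁ feasible)))
                                            (T-max JT (touching-part-feasible T (proj₁ feasible))) ⟩
  a + b                        ∎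
  where
  open Forests G
  open ≤-Reasoning
  open Spanning (spanning-extension (S ∪ T) Id (∩-feasible-∪ S T Id-feasible)) renaming (forest to J)
  JS JT : Subset (m G)
  JS = J ∩ touched S
  JT = J ∩ touched T
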